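{- Let $A$ be a ring, $I\subseteq A$ an ideal, $k\ge1$, and $x=(x_j)_{j\in[1,k]}$ a tuple of elements of $A$, with inner derivations $D_{x_j}:A\to A$, $y\mapsto yx_j-x_jy$. Let $h=(h_j)_{j\in[1,k]}$ and $l=(l_j)_{j\in[1,k]}$ be tuples of positive integers. Then \[ A(x,h,l)_I:=\Big\{y\in A:\ D_{x_1}^{i_1}\circ\cdots\circ D_{x_k}^{i_k}(y)\in I^{i_1l_1+\cdots+i_kl_k}\ \text{for all }(i_j)_j\in\textstyle\prod_{j\in[1,k]}[0,h_j]\Big\} \] is a subring of $A$.
   Context: $I^0:=A$. For integers $a\le b$, $[a,b]=\{c\in\mathbb Z: a\le c\le b\}$. -}

module Defs where

open import Level using (Level; _⊔_; Lift)
open import Algebra.Bundles using (Ring)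
open import Data.Nat using (ℕ; zero; suc; _+_; _*_)
open import Data.Fin using (Fin)
import Data.Fin as F
open import Data.Unit.Polymorphic using (⊤)
open import Relation.Unary using (Pred; _∈_)
open import Function using (id; _∘_)

module _ {c ℓ : Level} (R : Ring c ℓ) where
  open Ring R using (Carrier; _≈_; 0#; 1#; -_; _-_) renaming (_+_ to _+ᴿ_; _*_ to _*ᴿ_)

  record Ideal (ℓI : Level) : Set (c ⊔ ℓ ⊔ Level.suc ℓI) where
    field
      _∈I : Pred Carrier ℓI
      ∈-resp-≈ : ∀ {a b} → a ≈ b → a ∈I → b ∈I
      0∈ : 0# ∈I
      +-closed : ∀ {a b} → a ∈I → b ∈I → (a +ᴿ b) ∈I
      neg-closed : ∀ {a} → a ∈I → (- a) ∈I
      *ˡ-closed : ∀ r {a} → a ∈I → (r *ᴿ a) ∈I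
      *ʳ-closed : ∀ r {a} → a ∈I → (a *ᴿ r) ∈I

  data ProdSet {ℓJ ℓK : Level} (J : Pred Carrier ℓJ) (K : Pred Carrier ℓK)
       : Pred Carrier (c ⊔ ℓ ⊔ ℓJ ⊔ ℓK) where
    gen  : ∀ {a b} → J a → K b → ProdSet J K (a *ᴿ b)
    zer  : ProdSet J K 0#
    add  : ∀ {y z} → ProdSet J K y → ProdSet J K z → ProdSet J K (y +ᴿ z)
    neg  : ∀ {y} → ProdSet J K y → ProdSet J K (- y)
    resp : ∀ {y z} → y ≈ z → ProdSet J K y → ProdSet J K z

  IdealPow : ∀ {ℓI} → Ideal ℓI → ℕ → Pred Carrier (c ⊔ ℓ ⊔ ℓI)
  IdealPow I zero    = λ _ → ⊤
  IdealPow I (suc n) = ProdSet (Ideal._∈I I) (IdealPow I n)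

  D : Carrier → Carrier → Carrier
  D x y = (y *ᴿ x) - (x *ᴿ y)

  iter : (Carrier → Carrier) → ℕ → Carrier → Carrier
  iter f zero    = id
  iter f (suc n) = f ∘ iter f n

  Dcomp : (k : ℕ) → (Fin k → Carrier) → (Fin k → ℕ) → Carrier → Carrier
  Dcomp zero    x i = id
  Dcomp (suc k) x i = iter (D (x F.zero)) (i F.zero) ∘ Dcomp k (x ∘ F.suc) (i ∘ F.suc)

  wsum : (k : ℕ) → (Fin k → ℕ) → (Fin k → ℕ) → ℕ
  wsum zero    i l = 0
  wsum (suc k) i l = i F.zero * l F.zero + wsum k (i ∘ F.suc) (l ∘ F.suc)

  AxhlI : ∀ {ℓI} → Ideal ℓI → (k : ℕ) → (Fin k → Carrier) → (Fin k → ℕ) → (Fin k → ℕ)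
          → Pred Carrier (c ⊔ ℓ ⊔ ℓI)
  AxhlI I k x h l y =
    (i : Fin k → ℕ) → (∀ j → i j Data.Nat.≤ h j) →
    IdealPow I (wsum k i l) (Dcomp k x i y)

  record IsSubring {ℓP : Level} (P : Pred Carrier ℓP) : Set (c ⊔ ℓ ⊔ ℓP) where
    field
      ∈-resp-≈   : ∀ {a b} → a ≈ b → P a → P b
      0∈         : P 0#
      1∈         : P 1#
      +-closed   : ∀ {a b} → P a → P b → P (a +ᴿ b)
      neg-closed : ∀ {a} → P a → P (- a)
      *-closed   : ∀ {a b} → P a → P b → P (a *ᴿ b)

{-# OPTIONS --safe #-}
module Submission where

-- Encode D_{x_1}^{i_1} ∘ ⋯ ∘ D_{x_k}^{i_k} as a word in the letters (x_j , l_j). The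
-- multi-indices i ≤ h then correspond to the subwords of the word for h, so A(x,h,l)_I
-- consists of the a with D_v a ∈ I^(weight v) for every subword v. This condition is
-- preserved by products, by induction on the word: in the Leibniz rule
-- D_x (a b) = D_x a · b + a · D_x b the weight of the letter passes to one factor, and
-- I^m I^n ⊆ I^(m+n).

open import Defs
open import Level using (Level)
open import Algebra.Bundles using (Ring)
open import Data.Nat using (ℕ; zero; suc; _≤_; z≤n; s≤s)
open import Data.Fin using (Fin; zero; suc)

import Algebra.Properties.CommutativeSemigroup as CommutativeSemigroupProperties
import Algebra.Properties.Ring as RingProperties
open import Data.List using (List; []; _∷_; _++_; replicate)
import Data.Nat as ℕ
import Data.Nat.Properties as ℕ
open import Data.Product using (_×_; _,_)
open import Data.Unit.Polymorphic using (tt)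
open import Data.Vec.Functional using () renaming (_∷_ to _◂_)
open import Function using (id; _∘_)
open import Relation.Binary.PropositionalEquality as ≡ using (_≡_)
open import Relation.Unary using (Pred; _∈_; _≐_)

m*n+[n+o]≡[1+m]*n+o : ∀ m n o → m ℕ.* n ℕ.+ (n ℕ.+ o) ≡ suc m ℕ.* n ℕ.+ o
m*n+[n+o]≡[1+m]*n+o m n o =
  ≡.trans (≡.sym (ℕ.+-assoc (m ℕ.* n) n o)) (≡.cong (ℕ._+ o) (ℕ.+-comm (m ℕ.* n) n))

module InnerDerivations {c ℓ : Level} (R : Ring c ℓ) where
  open Ring R hiding (zero)
  open RingProperties R
  open CommutativeSemigroupProperties +-commutativeSemigroup using (interchange)
  open import Relation.Binary.Reasoning.Setoid setoid

  D-cong : ∀ x {a b} → a ≈ b → D R x a ≈ D R x b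
  D-cong x a≈b = +-cong (*-congʳ a≈b) (-‿cong (*-congˡ a≈b))

  D-+ : ∀ x a b → D R x (a + b) ≈ D R x a + D R x b
  D-+ x a b = begin
    (a + b) * x - x * (a + b)                 ≈⟨ +-cong (distribʳ x a b) (-‿cong (distribˡ x a b)) ⟩
    (a * x + b * x) - (x * a + x * b)         ≈⟨ +-congˡ (-‿+-comm (x * a) (x * b)) ⟨
    (a * x + b * x) + (- (x * a) + - (x * b)) ≈⟨ interchange _ _ _ _ ⟩
    D R x a + D R x b                         ∎

  D-neg : ∀ x a → D R x (- a) ≈ - D R x a
  D-neg x a = begin
    (- a) * x - x * (- a)     ≈⟨ +-cong (-‿distribˡ-* a x) (-‿cong (-‿distribʳ-* x a)) ⟨
    - (a * x) + - - (x * a)   ≈⟨ -‿+-comm _ _ ⟩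
    - D R x a                 ∎

  D-0# : ∀ x → D R x 0# ≈ 0#
  D-0# x = begin
    0# * x - x * 0#  ≈⟨ +-cong (zeroˡ x) (-‿cong (zeroʳ x)) ⟩
    0# - 0#          ≈⟨ -‿inverseʳ 0# ⟩
    0#               ∎

  D-1# : ∀ x → D R x 1# ≈ 0#
  D-1# x = begin
    1# * x - x * 1#  ≈⟨ +-cong (*-identityˡ x) (-‿cong (*-identityʳ x)) ⟩
    x - x            ≈⟨ -‿inverseʳ x ⟩
    0#               ∎

  D-* : ∀ x a b → D R x (a * b) ≈ D R x a * b + a * D R x b
  D-* x a b = sym (begin
    D R x a * b + a * D R x b
      ≈⟨ +-cong ([y-z]x≈yx-zx b (a * x) (x * a)) (x[y-z]≈xy-xz a (b * x) (x * b)) ⟩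
    ((a * x) * b - (x * a) * b) + (a * (b * x) - a * (x * b))
      ≈⟨ +-cong (+-cong (*-assoc a x b) (-‿cong (*-assoc x a b))) (+-congʳ (sym (*-assoc a b x))) ⟩
    (a * (x * b) - x * (a * b)) + ((a * b) * x - a * (x * b))
      ≈⟨ cancel (a * (x * b)) (x * (a * b)) ((a * b) * x) ⟩
    (a * b) * x - x * (a * b) ∎)
    where
      cancel : ∀ p q r → (p - q) + (r - p) ≈ r - q
      cancel p q r = begin
        (p - q) + (r - p)      ≈⟨ +-comm _ _ ⟩
        (r - p) + (p - q)      ≈⟨ +-assoc r (- p) (p - q) ⟩
        r + (- p + (p - q))    ≈⟨ +-congˡ (\\-leftDividesʳ p (- q)) ⟩
        r - q                  ∎

  -- A word lists derivations D_x with weights l, innermost first. AllSubwords Q u m a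
  -- says Q (weight v + m) (D_v a) for every subword v of u: the first component
  -- skips the innermost letter, the second applies it.
  AllSubwords : ∀ {q} → (ℕ → Carrier → Set q) → List (Carrier × ℕ) → ℕ → Carrier → Set q
  AllSubwords Q []            m a = Q m a
  AllSubwords Q ((x , l) ∷ u) m a = AllSubwords Q u m a × AllSubwords Q u (l ℕ.+ m) (D R x a)

  iter-suc : ∀ (f : Carrier → Carrier) n a → iter R f n (f a) ≡ f (iter R f n a)
  iter-suc f zero    a = ≡.refl
  iter-suc f (suc n) a = ≡.cong f (iter-suc f n a)

  module _ {q} {Q : ℕ → Carrier → Set q} where

    AllSubwords-empty : ∀ u {m a} → AllSubwords Q u m a → Q m a
    AllSubwords-empty []      H       = H
    AllSubwords-empty (_ ∷ u) (H , _) = AllSubwords-empty u H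

    AllSubwords-++ : ∀ u v m a → AllSubwords Q (u ++ v) m a ≡ AllSubwords (AllSubwords Q v) u m a
    AllSubwords-++ []            v m a = ≡.refl
    AllSubwords-++ ((x , l) ∷ u) v m a =
      ≡.cong₂ _×_ (AllSubwords-++ u v m a) (AllSubwords-++ u v (l ℕ.+ m) (D R x a))

    AllSubwords-replicate⁻ : ∀ n x l {m a} → AllSubwords Q (replicate n (x , l)) m a →
                             ∀ j → j ≤ n → Q (j ℕ.* l ℕ.+ m) (iter R (D R x) j a)
    AllSubwords-replicate⁻ n       x l H zero _ = AllSubwords-empty (replicate n (x , l)) H
    AllSubwords-replicate⁻ (suc n) x l {m} {a} (_ , H) (suc j) (s≤s j≤n) =
      ≡.subst₂ Q (m*n+[n+o]≡[1+m]*n+o j l m) (iter-suc (D R x) j a)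
        (AllSubwords-replicate⁻ n x l H j j≤n)

    AllSubwords-replicate⁺ : ∀ n x l {m a} →
                             (∀ j → j ≤ n → Q (j ℕ.* l ℕ.+ m) (iter R (D R x) j a)) →
                             AllSubwords Q (replicate n (x , l)) m a
    AllSubwords-replicate⁺ zero    x l H = H 0 z≤n
    AllSubwords-replicate⁺ (suc n) x l {m} {a} H =
      AllSubwords-replicate⁺ n x l (λ j j≤n → H j (ℕ.m≤n⇒m≤1+n j≤n)) ,
      AllSubwords-replicate⁺ n x l (λ j j≤n →
        ≡.subst₂ Q (≡.sym (m*n+[n+o]≡[1+m]*n+o j l m)) (≡.sym (iter-suc (D R x) j a))
          (H (suc j) (s≤s j≤n)))

  word : (k : ℕ) → (Fin k → Carrier) → (Fin k → ℕ) → (Fin k → ℕ) → List (Carrier × ℕ)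
  word zero    x l i = []
  word (suc k) x l i = word k (x ∘ suc) (l ∘ suc) (i ∘ suc) ++ replicate (i zero) (x zero , l zero)

  AllSubwords-word⁻ : ∀ {q} {Q : ℕ → Carrier → Set q} k x l h {m a} →
                      AllSubwords Q (word k x l h) m a →
                      ∀ i → (∀ j → i j ≤ h j) → Q (wsum R k i l ℕ.+ m) (Dcomp R k x i a)
  AllSubwords-word⁻ zero x l h H i i≤h = H
  AllSubwords-word⁻ {Q = Q} (suc k) x l h {m} {a} H i i≤h =
    ≡.subst₂ Q (≡.sym (ℕ.+-assoc (i zero ℕ.* l zero) _ m)) ≡.refl
      (AllSubwords-replicate⁻ (h zero) (x zero) (l zero)
        (AllSubwords-word⁻ k (x ∘ suc) (l ∘ suc) (h ∘ suc)
          (≡.subst id (AllSubwords-++ {Q = Q} (word k (x ∘ suc) (l ∘ suc) (h ∘ suc)) _ m a) H)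
          (i ∘ suc) (i≤h ∘ suc))
        (i zero) (i≤h zero))

  AllSubwords-word⁺ : ∀ {q} {Q : ℕ → Carrier → Set q} k x l h {m a} →
                      (∀ i → (∀ j → i j ≤ h j) → Q (wsum R k i l ℕ.+ m) (Dcomp R k x i a)) →
                      AllSubwords Q (word k x l h) m a
  AllSubwords-word⁺ zero x l h H = H (λ ()) (λ ())
  AllSubwords-word⁺ {Q = Q} (suc k) x l h {m} {a} H =
    ≡.subst id (≡.sym (AllSubwords-++ {Q = Q} (word k (x ∘ suc) (l ∘ suc) (h ∘ suc)) _ m a))
      (AllSubwords-word⁺ k (x ∘ suc) (l ∘ suc) (h ∘ suc) λ i i≤h →
        AllSubwords-replicate⁺ (h zero) (x zero) (l zero) λ j j≤h₀ →
          ≡.subst₂ Q (ℕ.+-assoc (j ℕ.* l zero) _ m) ≡.refl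
            (H (j ◂ i) λ { zero → j≤h₀ ; (suc t) → i≤h t }))

module IdealPowers {c ℓ ℓI : Level} (R : Ring c ℓ) (I : Ideal R ℓI) where
  open Ring R hiding (zero)
  open RingProperties R
  open Ideal I
  open InnerDerivations R

  I^_ : ℕ → Pred Carrier _
  I^_ = IdealPow R I

  I^-resp-≈ : ∀ n {a b} → a ≈ b → a ∈ I^ n → b ∈ I^ n
  I^-resp-≈ zero    _   _ = tt
  I^-resp-≈ (suc n) a≈b H = resp a≈b H

  0∈I^ : ∀ n → 0# ∈ I^ n
  0∈I^ zero    = tt
  0∈I^ (suc n) = zer

  I^-+-closed : ∀ n {a b} → a ∈ I^ n → b ∈ I^ n → a + b ∈ I^ n
  I^-+-closed zero    _ _  = tt
  I^-+-closed (suc n) H H′ = add H H′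

  I^-neg-closed : ∀ n {a} → a ∈ I^ n → - a ∈ I^ n
  I^-neg-closed zero    _ = tt
  I^-neg-closed (suc n) H = neg H

  I^-*ˡ-closed : ∀ n r {a} → a ∈ I^ n → r * a ∈ I^ n
  I^-*ˡ-closed zero    r _ = tt
  I^-*ˡ-closed (suc n) r (gen {a} {b} a∈I b∈I^n) =
    resp (*-assoc r a b) (gen (*ˡ-closed r a∈I) b∈I^n)
  I^-*ˡ-closed (suc n) r zer = resp (sym (zeroʳ r)) zer
  I^-*ˡ-closed (suc n) r (add {a} {b} H H′) =
    resp (sym (distribˡ r a b))
      (add (I^-*ˡ-closed (suc n) r H) (I^-*ˡ-closed (suc n) r H′))
  I^-*ˡ-closed (suc n) r (neg {a} H) = resp (-‿distribʳ-* r a) (neg (I^-*ˡ-closed (suc n) r H))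
  I^-*ˡ-closed (suc n) r (resp a≈b H) = resp (*-congˡ a≈b) (I^-*ˡ-closed (suc n) r H)

  I^-*-closed : ∀ m n {a b} → a ∈ I^ m → b ∈ I^ n → a * b ∈ I^ (m ℕ.+ n)
  I^-*-closed zero    n {a} _ H = I^-*ˡ-closed n a H
  I^-*-closed (suc m) n {b = b} (gen {a₁} {a₂} a₁∈I a₂∈I^m) H =
    resp (sym (*-assoc a₁ a₂ b)) (gen a₁∈I (I^-*-closed m n a₂∈I^m H))
  I^-*-closed (suc m) n {b = b} zer _ = resp (sym (zeroˡ b)) zer
  I^-*-closed (suc m) n {b = b} (add {a} {a′} H H′) H″ =
    resp (sym (distribʳ b a a′))
      (add (I^-*-closed (suc m) n H H″) (I^-*-closed (suc m) n H′ H″))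
  I^-*-closed (suc m) n {b = b} (neg {a} H) H′ =
    resp (-‿distribˡ-* a b) (neg (I^-*-closed (suc m) n H H′))
  I^-*-closed (suc m) n (resp a≈a′ H) H′ = resp (*-congʳ a≈a′) (I^-*-closed (suc m) n H H′)

  Adic : List (Carrier × ℕ) → ℕ → Pred Carrier _
  Adic = AllSubwords I^_

  Adic-resp-≈ : ∀ u {m a b} → a ≈ b → a ∈ Adic u m → b ∈ Adic u m
  Adic-resp-≈ []            {m} a≈b H    = I^-resp-≈ m a≈b H
  Adic-resp-≈ ((x , l) ∷ u) a≈b (H , H′) = Adic-resp-≈ u a≈b H , Adic-resp-≈ u (D-cong x a≈b) H′

  0∈Adic : ∀ u m → 0# ∈ Adic u m
  0∈Adic []            m = 0∈I^ m
  0∈Adic ((x , l) ∷ u) m = 0∈Adic u m , Adic-resp-≈ u (sym (D-0# x)) (0∈Adic u (l ℕ.+ m))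

  1∈Adic : ∀ u → 1# ∈ Adic u 0
  1∈Adic []            = tt
  1∈Adic ((x , l) ∷ u) = 1∈Adic u , Adic-resp-≈ u (sym (D-1# x)) (0∈Adic u (l ℕ.+ 0))

  Adic-+-closed : ∀ u {m a b} → a ∈ Adic u m → b ∈ Adic u m → a + b ∈ Adic u m
  Adic-+-closed []            {m} H H′ = I^-+-closed m H H′
  Adic-+-closed ((x , l) ∷ u) {a = a} {b} (H , Hx) (H′ , H′x) =
    Adic-+-closed u H H′ , Adic-resp-≈ u (sym (D-+ x a b)) (Adic-+-closed u Hx H′x)

  Adic-neg-closed : ∀ u {m a} → a ∈ Adic u m → - a ∈ Adic u m
  Adic-neg-closed []            {m} H = I^-neg-closed m H
  Adic-neg-closed ((x , l) ∷ u) {a = a} (H , Hx) =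
    Adic-neg-closed u H , Adic-resp-≈ u (sym (D-neg x a)) (Adic-neg-closed u Hx)

  Adic-*-closed : ∀ u {m n a b} → a ∈ Adic u m → b ∈ Adic u n → a * b ∈ Adic u (m ℕ.+ n)
  Adic-*-closed []            {m} {n} H H′ = I^-*-closed m n H H′
  Adic-*-closed ((x , l) ∷ u) {m} {n} {a} {b} (H , Hx) (H′ , H′x) =
    Adic-*-closed u H H′ ,
    Adic-resp-≈ u (sym (D-* x a b))
      (Adic-+-closed u (retag (ℕ.+-assoc l m n) (Adic-*-closed u Hx H′))
                       (retag (x∙yz≈y∙xz m l n) (Adic-*-closed u H H′x)))
    where
      open CommutativeSemigroupProperties ℕ.+-commutativeSemigroup using (x∙yz≈y∙xz)
      retag : ∀ {m′ n′ y} → m′ ≡ n′ → y ∈ Adic u m′ → y ∈ Adic u n′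
      retag m′≡n′ = ≡.subst₂ (Adic u) m′≡n′ ≡.refl

  Adic-isSubring : ∀ u → IsSubring R (Adic u 0)
  Adic-isSubring u = record
    { ∈-resp-≈   = Adic-resp-≈ u
    ; 0∈         = 0∈Adic u 0
    ; 1∈         = 1∈Adic u
    ; +-closed   = Adic-+-closed u
    ; neg-closed = Adic-neg-closed u
    ; *-closed   = Adic-*-closed u
    }

  AxhlI≐Adic : ∀ k x h l → AxhlI R I k x h l ≐ Adic (word k x l h) 0
  AxhlI≐Adic k x h l =
    (λ H → AllSubwords-word⁺ k x l h λ i i≤h →
             ≡.subst₂ I^_ (≡.sym (ℕ.+-identityʳ (wsum R k i l))) ≡.refl (H i i≤h)) ,
    (λ H i i≤h → ≡.subst₂ I^_ (ℕ.+-identityʳ (wsum R k i l)) ≡.refl (AllSubwords-word⁻ k x l h H i i≤h))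

IsSubring-resp-≐ : ∀ {c ℓ ℓP ℓQ} (R : Ring c ℓ)
                   {P : Pred (Ring.Carrier R) ℓP} {Q : Pred (Ring.Carrier R) ℓQ} →
                   P ≐ Q → IsSubring R Q → IsSubring R P
IsSubring-resp-≐ R (P⊆Q , Q⊆P) Q-subring = record
  { ∈-resp-≈   = λ a≈b → Q⊆P ∘ ∈-resp-≈ a≈b ∘ P⊆Q
  ; 0∈         = Q⊆P 0∈
  ; 1∈         = Q⊆P 1∈
  ; +-closed   = λ a∈P b∈P → Q⊆P (+-closed (P⊆Q a∈P) (P⊆Q b∈P))
  ; neg-closed = Q⊆P ∘ neg-closed ∘ P⊆Q
  ; *-closed   = λ a∈P b∈P → Q⊆P (*-closed (P⊆Q a∈P) (P⊆Q b∈P))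
  }
  where open IsSubring Q-subring

lemma1p1 : {c ℓ ℓI : Level} (R : Ring c ℓ) (I : Ideal R ℓI) (k : ℕ) → 1 ≤ k →
    (x : Fin k → Ring.Carrier R) (h l : Fin k → ℕ) →
    (∀ j → 1 ≤ h j) → (∀ j → 1 ≤ l j) →
    IsSubring R (AxhlI R I k x h l)
lemma1p1 R I k _ x h l _ _ =
  IsSubring-resp-≐ R (AxhlI≐Adic k x h l) (Adic-isSubring (word k x l h))
  where
    open InnerDerivations R using (word)
    open IdealPowers R I
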